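{- Let $F\in\mathrm{Hom}(m,n)$ be a reshuffle. Say $F$ has $k$ left adjoints if there are reshuffles $L_1,\ldots,L_k$ with $L_k\dashv\cdots\dashv L_1\dashv F$, and $k$ right adjoints if there are $R_1,\ldots,R_k$ with $F\dashv R_1\dashv\cdots\dashv R_k$. If $m,n\geq0$, then: $F$ has 1 left adjoint iff $(=\cdot F)=(=)$; 2 left adjoints iff $(=\cdot F)=(=)$ and $0\cdot F\geq0$; 3 left adjoints iff $(=\cdot F)=(=)$ and $0\cdot F=0$; 1 right adjoint iff $n\cdot F<\top$; 2 right adjoints iff $n\cdot F=m$. If $m=-1$ and $n\geq0$: $F$ has 1 left adjoint iff $F$ is of the form $[=\,|\,=,\ldots,=,\top,\ldots,\top]$ (some initial segment of $0,\dots,n$ mapped to $=$, the rest to $\top$); 2 (equivalently 3) left adjoints iff $F=[=\,|\,\top,\ldots,\top]$; 1 (equivalently 2) right adjoints iff $F=[=\,|\,=,\ldots,=]$. If $m\geq0$ and $n=-1$: $F$ has 1 (equivalently 2) left adjoints iff $F=[=\,|\,]$ (i.e. $=\cdot F\,=\,=$); it never has 3 left adjoints; it has 1 right adjoint iff $=\cdot F<\top$; 2 right adjoints iff $=\cdot F=m$. The only reshuffles in $\mathrm{Hom}(-1,-1)$ are $[=\,|\,]$, which is the identity and self-adjoint, and $[\top\,|\,]$, which has neither a left nor a right adjoint.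
   Context: Index sets are totally ordered as $=\,<0<1<\cdots<\top$. For integers $m,n\geq-1$, a reshuffle $F\in\mathrm{Hom}(m,n)$ is an increasing function $F:\{=,0,\ldots,n\}\to\{=,0,\ldots,m,\top\}$, $k\mapsto k\cdot F$, written $[=\cdot F\,|\,0\cdot F,\ldots,n\cdot F]$; it is extended by $\top\cdot F=\top$. Reshuffles are ordered pointwise. Identity: $k\cdot\mathrm{id}=k$; composition $k\cdot(G\circ F)=(k\cdot G)\cdot F$. $L\in\mathrm{Hom}(x,y)$ is left adjoint to $R\in\mathrm{Hom}(y,x)$ ($L\dashv R$) if $\mathrm{id}_x\leq R\circ L$ and $L\circ R\leq\mathrm{id}_y$. -}

module Defs where

open import Data.Nat as ℕ using (ℕ; zero; suc)
open import Data.Fin using (Fin; zero; suc; toℕ; fromℕ; inject₁)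
open import Data.Product using (Σ; _×_)
open import Data.Unit using (⊤)

-- Indexing convention: the paper's integer m ≥ -1 is represented by the
-- natural number a = m + 1.  So  Hom a b  is the paper's Hom(a-1, b-1).
--
-- Ordered index set {=, 0, …, m, ⊤} for m = a - 1 is  Fin (suc (suc a)):
--   '='  ↦ zero,   j (0 ≤ j ≤ m) ↦ j + 1,   '⊤' ↦ fromℕ (suc a)  (= a + 1).
-- Domain {=, 0, …, n} for n = b - 1 is  Fin (suc b):  '=' ↦ zero,  k ↦ k + 1.
-- The order is the usual order of Fin (i.e. the order of toℕ).

_≤ᶠ_ : {c d : ℕ} → (Fin c → Fin d) → (Fin c → Fin d) → Set
f ≤ᶠ g = ∀ i → toℕ (f i) ℕ.≤ toℕ (g i)

-- a reshuffle  F ∈ Hom(a-1, b-1) : increasing map {=,0..n} → {=,0..m,⊤}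
record Hom (a b : ℕ) : Set where
  constructor reshuffle
  field
    fun  : Fin (suc b) → Fin (suc (suc a))
    mono : ∀ {i j : Fin (suc b)} → toℕ i ℕ.≤ toℕ j → toℕ (fun i) ℕ.≤ toℕ (fun j)

open Hom public

_·_ : {a b : ℕ} → Hom a b → Fin (suc b) → Fin (suc (suc a))
F · k = fun F k

-- extension of a function on {=,0..n} to {=,0..n,⊤} by ⊤ ↦ ⊤
extend : {b c : ℕ} → (Fin (suc b) → Fin (suc (suc c))) → Fin (suc (suc b)) → Fin (suc (suc c))
extend {zero}  {c} f zero    = f zero
extend {zero}  {c} f (suc _) = fromℕ (suc c)
extend {suc b} {c} f zero    = f zero
extend {suc b} {c} f (suc i) = extend {b} {c} (λ j → f (suc j)) i

_·⁺_ : {a b : ℕ} → Hom a b → Fin (suc (suc b)) → Fin (suc (suc a))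
F ·⁺ k = extend (fun F) k

-- underlying function of the composite  G ∘ F ∈ Hom(m,p)  for  G ∈ Hom(n,p),
-- F ∈ Hom(m,n):   k · (G ∘ F) = (k · G) · F
_∘ʳ_ : {a b c : ℕ} → Hom b c → Hom a b → Fin (suc c) → Fin (suc (suc a))
(G ∘ʳ F) k = F ·⁺ (G · k)

idʳ : {a : ℕ} → Fin (suc a) → Fin (suc (suc a))
idʳ k = inject₁ k

_⊣_ : {a b : ℕ} → Hom a b → Hom b a → Set
L ⊣ R = (idʳ ≤ᶠ (R ∘ʳ L)) × ((L ∘ʳ R) ≤ᶠ idʳ)

HasLeftAdjoints : ℕ → {a b : ℕ} → Hom a b → Set
HasLeftAdjoints zero          F = ⊤
HasLeftAdjoints (suc k) {a} {b} F = Σ (Hom b a) (λ L → (L ⊣ F) × HasLeftAdjoints k L)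

HasRightAdjoints : ℕ → {a b : ℕ} → Hom a b → Set
HasRightAdjoints zero          F = ⊤
HasRightAdjoints (suc k) {a} {b} F = Σ (Hom b a) (λ R → (F ⊣ R) × HasRightAdjoints k R)

module Submission where

-- The whole argument rests on one reformulation: L ⊣ R holds exactly when
-- L never takes the value ⊤ and  y · R ≤ x  ⇔  y ≤ x · L  for all finite
-- indices x, y (a Galois connection; 'adjoint⇒galois', 'galois⇒adjoint').  From it:
--   * a right adjoint R always satisfies  = · R = = , and a left adjoint
--     lands below ⊤;
--   * conversely, if  = · R = =  then  x ↦ max { y | y · R ≤ x }  is a left
--     adjoint of R, and if  n · L < ⊤  then  y ↦ min { x | y ≤ x · L }
--     (the minimum taken in {=,0,…,n,⊤}) is a right adjoint of L.  Both
--     extrema are found by a finite search ('greatest', 'least').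
-- Hence F has a left adjoint iff  = · F = = , and a right adjoint iff
-- n · F < ⊤.  Longer chains are handled by evaluating the Galois
-- connection at the points = , 0 and ⊤: e.g. the left adjoint L of F
-- fixes = iff  0 · F ≥ 0 , which is how each further adjoint in a chain
-- translates into one more condition on F.

open import Data.Nat using (ℕ; zero; suc; _≤_; _<_; _≤?_; z≤n; s≤s)
open import Data.Nat.Properties
  using (≤-refl; ≤-trans; ≤-antisym; ≤-pred; <⇒≱; ≰⇒>; ≮⇒≥; 1+n≰n; n≤0⇒n≡0; n<1⇒n≡0; module ≤-Reasoning)
open import Data.Fin using (Fin; zero; suc; toℕ; fromℕ; inject₁)
open import Data.Fin.Properties using (0≢1+n; toℕ-injective; toℕ-inject₁; toℕ-fromℕ; toℕ≤pred[n]; toℕ≤n; ≤fromℕ)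
open import Data.Fin.Relation.Unary.Top using (view; ‵fromℕ; ‵inj₁)
open import Data.Product using (Σ; _×_; _,_; proj₁; proj₂)
open import Data.Product.Function.NonDependent.Propositional using (_×-⇔_)
open import Data.Sum using (_⊎_; inj₁; inj₂)
open import Data.Empty using (⊥-elim)
open import Data.Unit using (tt)
open import Level using (Level)
open import Relation.Nullary using (¬_; yes; no)
open import Relation.Unary using (Pred; Decidable)
open import Relation.Binary.PropositionalEquality using (_≡_; refl; sym; trans; cong; subst)
open import Function.Bundles using (_⇔_; mk⇔; module Equivalence)
open import Function.Properties.Equivalence using () renaming (refl to ⇔-refl; trans to ⇔-trans)
open import Defs

open Equivalence using (to; from)

Monotone : ∀ {p q} → (Fin p → Fin q) → Set
Monotone f = ∀ {i j} → toℕ i ≤ toℕ j → toℕ (f i) ≤ toℕ (f j)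

inject₁≤ : ∀ {c} (j : Fin (suc c)) → toℕ (inject₁ j) ≤ c
inject₁≤ j rewrite toℕ-inject₁ j = toℕ≤pred[n] j

inject₁-mono : ∀ {c} {i j : Fin c} → toℕ i ≤ toℕ j → toℕ (inject₁ i) ≤ toℕ (inject₁ j)
inject₁-mono {i = i} {j} i≤j rewrite toℕ-inject₁ i | toℕ-inject₁ j = i≤j

below-top : ∀ {c} (y : Fin (suc c)) → toℕ y ≤ toℕ (fromℕ (suc c))
below-top {c} y rewrite toℕ-fromℕ (suc c) = toℕ≤n y

top≰ : ∀ c → ¬ (toℕ (fromℕ (suc c)) ≤ c)
top≰ c rewrite toℕ-fromℕ (suc c) = 1+n≰n

toℕ≤0⇒zero : ∀ {c} {i : Fin (suc c)} → toℕ i ≤ 0 → i ≡ zero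
toℕ≤0⇒zero i≤0 = toℕ-injective (n≤0⇒n≡0 i≤0)

positive⇒top : (i : Fin 2) → ¬ (toℕ i ≤ 0) → i ≡ suc zero
positive⇒top zero     i≰0 = ⊥-elim (i≰0 z≤n)
positive⇒top (suc zero) _ = refl

extend-inject₁ : ∀ {b c} (f : Fin (suc b) → Fin (suc (suc c))) (j : Fin (suc b)) →
                 extend f (inject₁ j) ≡ f j
extend-inject₁ {zero}  f zero    = refl
extend-inject₁ {suc b} f zero    = refl
extend-inject₁ {suc b} f (suc j) = extend-inject₁ (λ k → f (suc k)) j

extend-top : ∀ {b c} (f : Fin (suc b) → Fin (suc (suc c))) → extend f (fromℕ (suc b)) ≡ fromℕ (suc c)
extend-top {zero}  f = refl
extend-top {suc b} f = extend-top (λ k → f (suc k))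

extend-mono : ∀ {b c} (f : Fin (suc b) → Fin (suc (suc c))) → Monotone f → Monotone (extend f)
extend-mono {b} f f-mono {i} {j} i≤j with view j
... | ‵fromℕ rewrite extend-top f = ≤fromℕ (extend f i)
... | ‵inj₁ {i = j′} _ with view i
...   | ‵fromℕ = ⊥-elim (top≰ b (≤-trans i≤j (inject₁≤ j′)))
...   | ‵inj₁ {i = i′} _ rewrite extend-inject₁ f i′ | extend-inject₁ f j′
        | toℕ-inject₁ i′ | toℕ-inject₁ j′ = f-mono i≤j

extend-finite : ∀ {c d} (f : Fin (suc c) → Fin (suc (suc d))) (i : Fin (suc (suc c))) →
                toℕ (extend f i) ≤ d → toℕ i ≤ c
extend-finite {c} {d} f i fi≤d with view i
... | ‵fromℕ = ⊥-elim (top≰ d (subst (λ t → toℕ t ≤ d) (extend-top f) fi≤d))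
... | ‵inj₁ {i = j} _ = inject₁≤ j

greatest : ∀ {ℓ : Level} {n} {P : Pred (Fin (suc n)) ℓ} → Decidable P → P zero →
           Σ (Fin (suc n)) λ y → P y × (∀ z → P z → toℕ z ≤ toℕ y)
greatest {n = zero} P? p0 = zero , p0 , λ { zero _ → z≤n }
greatest {n = suc n} {P} P? p0 with P? (fromℕ (suc n))
... | yes p-top = fromℕ (suc n) , p-top , λ z _ → ≤fromℕ z
... | no ¬p-top with greatest {P = λ i → P (inject₁ i)} (λ i → P? (inject₁ i)) p0
...   | y , py , y-max = inject₁ y , py , below-y
  where
  below-y : ∀ z → P z → toℕ z ≤ toℕ (inject₁ y)
  below-y z pz with view z
  ... | ‵fromℕ = ⊥-elim (¬p-top pz)
  ... | ‵inj₁ {i = z′} _ = inject₁-mono (y-max z′ pz)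

least : ∀ {ℓ : Level} {n} {P : Pred (Fin (suc n)) ℓ} → Decidable P → P (fromℕ n) →
        Σ (Fin (suc n)) λ x → P x × (∀ z → P z → toℕ x ≤ toℕ z)
least {n = zero} P? p-top = zero , p-top , λ _ _ → z≤n
least {n = suc n} {P} P? p-top with P? zero
... | yes p0 = zero , p0 , λ _ _ → z≤n
... | no ¬p0 with least {P = λ i → P (suc i)} (λ i → P? (suc i)) p-top
...   | x , px , x-min = suc x , px , above-x
  where
  above-x : ∀ z → P z → toℕ (suc x) ≤ toℕ z
  above-x zero    p0 = ⊥-elim (¬p0 p0)
  above-x (suc z) pz = s≤s (x-min z pz)

record Galois {a b : ℕ} (L : Hom a b) (R : Hom b a) : Set where
  field
    bounded : ∀ x → toℕ (L · x) ≤ a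
    R≤⇒≤L   : ∀ y x → toℕ (R · y) ≤ toℕ x → toℕ y ≤ toℕ (L · x)
    ≤L⇒R≤   : ∀ y x → toℕ y ≤ toℕ (L · x) → toℕ (R · y) ≤ toℕ x

open Galois

-- An adjunction is a Galois connection: transpose along the unit and counit.
adjoint⇒galois : ∀ {a b} (L : Hom a b) (R : Hom b a) → L ⊣ R → Galois L R
adjoint⇒galois {a} {b} L R (unit , counit) = record
  { bounded = λ x → extend-finite (fun R) (L · x) (≤-trans (counit x) (inject₁≤ x))
  ; R≤⇒≤L   = R≤⇒≤L′
  ; ≤L⇒R≤   = ≤L⇒R≤′
  }
  where
  open ≤-Reasoning
  R≤⇒≤L′ : ∀ y x → toℕ (R · y) ≤ toℕ x → toℕ y ≤ toℕ (L · x)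
  R≤⇒≤L′ y x Ry≤x = begin
    toℕ y                     ≡⟨ sym (toℕ-inject₁ y) ⟩
    toℕ (inject₁ y)           ≤⟨ unit y ⟩
    toℕ (L ·⁺ (R · y))        ≤⟨ extend-mono (fun L) (mono L) (subst (toℕ (R · y) ≤_) (sym (toℕ-inject₁ x)) Ry≤x) ⟩
    toℕ (L ·⁺ inject₁ x)      ≡⟨ cong toℕ (extend-inject₁ (fun L) x) ⟩
    toℕ (L · x)               ∎
  ≤L⇒R≤′ : ∀ y x → toℕ y ≤ toℕ (L · x) → toℕ (R · y) ≤ toℕ x
  ≤L⇒R≤′ y x y≤Lx = begin
    toℕ (R · y)               ≡⟨ cong toℕ (sym (extend-inject₁ (fun R) y)) ⟩
    toℕ (R ·⁺ inject₁ y)      ≤⟨ extend-mono (fun R) (mono R) (subst (_≤ toℕ (L · x)) (sym (toℕ-inject₁ y)) y≤Lx) ⟩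
    toℕ (R ·⁺ (L · x))        ≤⟨ counit x ⟩
    toℕ (inject₁ x)           ≡⟨ toℕ-inject₁ x ⟩
    toℕ x                     ∎

galois⇒adjoint : ∀ {a b} {L : Hom a b} {R : Hom b a} → Galois L R → L ⊣ R
galois⇒adjoint {a} {b} {L} {R} g = unit , counit
  where
  unit-at : ∀ y (i : Fin (suc (suc b))) → toℕ (R · y) ≤ toℕ i → toℕ y ≤ toℕ (L ·⁺ i)
  unit-at y i Ry≤i with view i
  ... | ‵fromℕ rewrite extend-top (fun L) = below-top y
  ... | ‵inj₁ {i = x} _ rewrite extend-inject₁ (fun L) x | toℕ-inject₁ x = R≤⇒≤L g y x Ry≤i
  unit : idʳ ≤ᶠ (R ∘ʳ L)
  unit y = subst (_≤ toℕ (L ·⁺ (R · y))) (sym (toℕ-inject₁ y)) (unit-at y (R · y) ≤-refl)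
  counit-at : ∀ x (i : Fin (suc (suc a))) → toℕ i ≤ toℕ (L · x) → toℕ i ≤ a → toℕ (R ·⁺ i) ≤ toℕ x
  counit-at x i i≤Lx i≤a with view i
  ... | ‵fromℕ = ⊥-elim (top≰ a i≤a)
  ... | ‵inj₁ {i = y} _ rewrite extend-inject₁ (fun R) y | toℕ-inject₁ y = ≤L⇒R≤ g y x i≤Lx
  counit : (L ∘ʳ R) ≤ᶠ idʳ
  counit x = subst (toℕ (R ·⁺ (L · x)) ≤_) (sym (toℕ-inject₁ x))
                   (counit-at x (L · x) ≤-refl (bounded g x))

left-adjoint-exists : ∀ {a b} (R : Hom b a) → R · zero ≡ zero → Σ (Hom a b) (_⊣ R)
left-adjoint-exists {a} {b} R R-zero = L , galois⇒adjoint galois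
  where
  largest : (x : Fin (suc b)) →
            Σ (Fin (suc a)) λ y → toℕ (R · y) ≤ toℕ x × (∀ z → toℕ (R · z) ≤ toℕ x → toℕ z ≤ toℕ y)
  largest x = greatest (λ y → toℕ (R · y) ≤? toℕ x) (subst (λ t → toℕ t ≤ toℕ x) (sym R-zero) z≤n)
  l : Fin (suc b) → Fin (suc a)
  l x = proj₁ (largest x)
  l-below : ∀ x → toℕ (R · l x) ≤ toℕ x
  l-below x = proj₁ (proj₂ (largest x))
  l-max : ∀ x z → toℕ (R · z) ≤ toℕ x → toℕ z ≤ toℕ (l x)
  l-max x = proj₂ (proj₂ (largest x))
  l-mono : Monotone (λ x → inject₁ (l x))
  l-mono {i} {j} i≤j = inject₁-mono (l-max j (l i) (≤-trans (l-below i) i≤j))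
  L : Hom a b
  L = reshuffle (λ x → inject₁ (l x)) l-mono
  galois : Galois L R
  galois = record
    { bounded = λ x → inject₁≤ (l x)
    ; R≤⇒≤L   = λ y x Ry≤x → subst (toℕ y ≤_) (sym (toℕ-inject₁ (l x))) (l-max x y Ry≤x)
    ; ≤L⇒R≤   = λ y x y≤Lx → ≤-trans (mono R (subst (toℕ y ≤_) (toℕ-inject₁ (l x)) y≤Lx)) (l-below x)
    }

right-adjoint-exists : ∀ {a b} (L : Hom a b) → toℕ (L · fromℕ b) ≤ a → Σ (Hom b a) (L ⊣_)
right-adjoint-exists {a} {b} L L-top = R , galois⇒adjoint galois
  where
  smallest : (y : Fin (suc a)) →
             Σ (Fin (suc (suc b))) λ x → toℕ y ≤ toℕ (L ·⁺ x) × (∀ z → toℕ y ≤ toℕ (L ·⁺ z) → toℕ x ≤ toℕ z)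
  smallest y = least (λ x → toℕ y ≤? toℕ (L ·⁺ x))
                     (subst (λ t → toℕ y ≤ toℕ t) (sym (extend-top (fun L))) (below-top y))
  r : Fin (suc a) → Fin (suc (suc b))
  r y = proj₁ (smallest y)
  r-above : ∀ y → toℕ y ≤ toℕ (L ·⁺ r y)
  r-above y = proj₁ (proj₂ (smallest y))
  r-min : ∀ y z → toℕ y ≤ toℕ (L ·⁺ z) → toℕ (r y) ≤ toℕ z
  r-min y = proj₂ (proj₂ (smallest y))
  r-mono : Monotone r
  r-mono {i} {j} i≤j = r-min i (r j) (≤-trans i≤j (r-above j))
  R : Hom b a
  R = reshuffle r r-mono
  L⁺-inject₁ : ∀ x → toℕ (L ·⁺ inject₁ x) ≡ toℕ (L · x)
  L⁺-inject₁ x = cong toℕ (extend-inject₁ (fun L) x)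
  galois : Galois L R
  galois = record
    { bounded = λ x → ≤-trans (mono L (≤fromℕ x)) L-top
    ; R≤⇒≤L   = λ y x ry≤x → subst (toℕ y ≤_) (L⁺-inject₁ x)
        (≤-trans (r-above y) (extend-mono (fun L) (mono L) (subst (toℕ (r y) ≤_) (sym (toℕ-inject₁ x)) ry≤x)))
    ; ≤L⇒R≤   = λ y x y≤Lx → subst (toℕ (r y) ≤_) (toℕ-inject₁ x)
        (r-min y (inject₁ x) (subst (toℕ y ≤_) (sym (L⁺-inject₁ x)) y≤Lx))
    }

right-adjoint-bottom : ∀ {a b} (L : Hom a b) (R : Hom b a) → L ⊣ R → R · zero ≡ zero
right-adjoint-bottom L R L⊣R = toℕ≤0⇒zero (≤L⇒R≤ (adjoint⇒galois L R L⊣R) zero zero z≤n)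

left-adjoint-bottom : ∀ {a n} (L : Hom (suc n) a) (F : Hom a (suc n)) → L ⊣ F →
                      (L · zero ≡ zero) ⇔ (1 ≤ toℕ (F · suc zero))
left-adjoint-bottom L F L⊣F = mk⇔
  (λ L-zero → ≰⇒> (λ F1≤0 → <⇒≱ (R≤⇒≤L g (suc zero) zero F1≤0) (subst (λ t → toℕ t ≤ 0) (sym L-zero) z≤n)))
  (λ F1≥1 → toℕ≤0⇒zero (≮⇒≥ (λ L0≥1 → <⇒≱ F1≥1 (≤L⇒R≤ g (suc zero) zero L0≥1))))
  where
  g : Galois L F
  g = adjoint⇒galois L F L⊣F

right-adjoint-top : ∀ {a b} (F : Hom a b) (R : Hom b a) → F ⊣ R →
                    (toℕ (R · fromℕ a) ≤ b) ⇔ (a ≤ toℕ (F · fromℕ b))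
right-adjoint-top {a} {b} F R F⊣R = mk⇔
  (λ R-top≤b → subst (_≤ F-top) (toℕ-fromℕ a) (R≤⇒≤L g (fromℕ a) (fromℕ b) (subst (R-top ≤_) (sym (toℕ-fromℕ b)) R-top≤b)))
  (λ a≤F-top → subst (R-top ≤_) (toℕ-fromℕ b) (≤L⇒R≤ g (fromℕ a) (fromℕ b) (subst (_≤ F-top) (sym (toℕ-fromℕ a)) a≤F-top)))
  where
  F-top R-top : ℕ
  F-top = toℕ (F · fromℕ b)
  R-top = toℕ (R · fromℕ a)
  g : Galois F R
  g = adjoint⇒galois F R F⊣R

-- A left adjoint in Hom(-1, n) takes only the value = ; in particular it has a left adjoint.
left-adjoint-from-Hom0 : ∀ {b} (L : Hom 0 b) (R : Hom b 0) → L ⊣ R → HasLeftAdjoints 1 L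
left-adjoint-from-Hom0 L R L⊣R with left-adjoint-exists L (toℕ≤0⇒zero (bounded (adjoint⇒galois L R L⊣R) zero))
... | L′ , L′⊣L = L′ , L′⊣L , tt

identity-self-adjoint : ∀ {a} (F : Hom a a) → (∀ k → F · k ≡ idʳ k) → F ⊣ F
identity-self-adjoint {a} F F-id = galois⇒adjoint galois
  where
  toℕ-id : ∀ k → toℕ (F · k) ≡ toℕ k
  toℕ-id k rewrite F-id k = toℕ-inject₁ k
  galois : Galois F F
  galois = record
    { bounded = λ x → subst (λ t → toℕ t ≤ a) (sym (F-id x)) (inject₁≤ x)
    ; R≤⇒≤L   = λ y x Fy≤x → subst (toℕ y ≤_) (sym (toℕ-id x)) (subst (_≤ toℕ x) (toℕ-id y) Fy≤x)
    ; ≤L⇒R≤   = λ y x y≤Fx → subst (_≤ toℕ x) (sym (toℕ-id y)) (subst (toℕ y ≤_) (toℕ-id x) y≤Fx)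
    }

constant-bottom : ∀ {a b} (F : Hom a b) → (toℕ (F · fromℕ b) ≡ 0) ⇔ (∀ k → F · k ≡ zero)
constant-bottom {b = b} F = mk⇔
  (λ F-top → λ k → toℕ≤0⇒zero (subst (toℕ (F · k) ≤_) F-top (mono F (≤fromℕ k))))
  (λ F-zero → cong toℕ (F-zero (fromℕ b)))

has-left-adjoint : ∀ {a b} (F : Hom a b) → HasLeftAdjoints 1 F ⇔ (F · zero ≡ zero)
has-left-adjoint F = mk⇔
  (λ { (L , L⊣F , tt) → right-adjoint-bottom L F L⊣F })
  (λ F-zero → let (L , L⊣F) = left-adjoint-exists F F-zero in L , L⊣F , tt)

has-right-adjoint : ∀ {a b} (F : Hom a b) → HasRightAdjoints 1 F ⇔ (toℕ (F · fromℕ b) < suc a)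
has-right-adjoint {b = b} F = mk⇔
  (λ { (R , F⊣R , tt) → s≤s (bounded (adjoint⇒galois F R F⊣R) (fromℕ b)) })
  (λ F-top → let (R , F⊣R) = right-adjoint-exists F (≤-pred F-top) in R , F⊣R , tt)

has-two-right-adjoints : ∀ {a b} (F : Hom a b) → HasRightAdjoints 2 F ⇔ (toℕ (F · fromℕ b) ≡ a)
has-two-right-adjoints {a} {b} F = mk⇔ necessary sufficient
  where
  necessary : HasRightAdjoints 2 F → toℕ (F · fromℕ b) ≡ a
  necessary (R , F⊣R , R′ , R⊣R′ , tt) =
    ≤-antisym (bounded (adjoint⇒galois F R F⊣R) (fromℕ b))
              (to (right-adjoint-top F R F⊣R) (bounded (adjoint⇒galois R R′ R⊣R′) (fromℕ a)))
  sufficient : toℕ (F · fromℕ b) ≡ a → HasRightAdjoints 2 F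
  sufficient F-top with right-adjoint-exists F (subst (_≤ a) (sym F-top) ≤-refl)
  ... | R , F⊣R with right-adjoint-exists R (from (right-adjoint-top F R F⊣R) (subst (a ≤_) (sym F-top) ≤-refl))
  ...   | R′ , R⊣R′ = R , F⊣R , R′ , R⊣R′ , tt

has-two-left-adjoints : ∀ {a n} (F : Hom a (suc n)) →
                        HasLeftAdjoints 2 F ⇔ ((F · zero ≡ zero) × (1 ≤ toℕ (F · suc zero)))
has-two-left-adjoints F = mk⇔
  (λ { (L , L⊣F , L′ , L′⊣L , tt) → right-adjoint-bottom L F L⊣F , to (left-adjoint-bottom L F L⊣F) (right-adjoint-bottom L′ L L′⊣L) })
  (λ { (F-zero , F1≥1) → let (L , L⊣F) = left-adjoint-exists F F-zero
                          in L , L⊣F , from (has-left-adjoint L) (from (left-adjoint-bottom L F L⊣F) F1≥1) })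

-- For m, n ≥ 0, F has three left adjoints iff  = · F = =  and  0 · F = 0 : applying the
-- previous lemma to L ⊣ F, the condition  0 · L ≥ 0  translates into  0 · F ≤ 0 .
has-three-left-adjoints : ∀ {m n} (F : Hom (suc m) (suc n)) →
                          HasLeftAdjoints 3 F ⇔ ((F · zero ≡ zero) × (toℕ (F · suc zero) ≡ 1))
has-three-left-adjoints F = mk⇔ necessary sufficient
  where
  necessary : HasLeftAdjoints 3 F → (F · zero ≡ zero) × (toℕ (F · suc zero) ≡ 1)
  necessary (L , L⊣F , L-chain) with to (has-two-left-adjoints L) L-chain
  ... | L-zero , L1≥1 = right-adjoint-bottom L F L⊣F
                      , ≤-antisym (≤L⇒R≤ (adjoint⇒galois L F L⊣F) (suc zero) (suc zero) L1≥1)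
                                  (to (left-adjoint-bottom L F L⊣F) L-zero)
  sufficient : (F · zero ≡ zero) × (toℕ (F · suc zero) ≡ 1) → HasLeftAdjoints 3 F
  sufficient (F-zero , F1≡1) with left-adjoint-exists F F-zero
  ... | L , L⊣F = L , L⊣F , from (has-two-left-adjoints L)
        ( from (left-adjoint-bottom L F L⊣F) (subst (1 ≤_) (sym F1≡1) ≤-refl)
        , R≤⇒≤L (adjoint⇒galois L F L⊣F) (suc zero) (suc zero) (subst (_≤ 1) (sym F1≡1) ≤-refl))

threshold-form : ∀ {b} (F : Hom 0 b) →
                 HasLeftAdjoints 1 F ⇔ Σ ℕ (λ j → ∀ (k : Fin (suc b)) →
                   (toℕ k ≤ j → F · k ≡ zero) × (j < toℕ k → F · k ≡ suc zero))
threshold-form F = mk⇔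
  (λ { (L , L⊣F , tt) → let g = adjoint⇒galois L F L⊣F in toℕ (L · zero) , λ k →
        (λ k≤j → toℕ≤0⇒zero (≤L⇒R≤ g k zero k≤j))
      , (λ j<k → positive⇒top (F · k) (λ Fk≤0 → <⇒≱ j<k (R≤⇒≤L g k zero Fk≤0))) })
  (λ { (_ , F-shape) → from (has-left-adjoint F) (proj₁ (F-shape zero) z≤n) })

jumps-at-zero : ∀ {n} (F : Hom 0 (suc n)) → (1 ≤ toℕ (F · suc zero)) ⇔ (∀ k → F · suc k ≡ suc zero)
jumps-at-zero F = mk⇔
  (λ F1≥1 k → positive⇒top (F · suc k) (λ Fk≤0 → <⇒≱ F1≥1 (≤-trans (mono F (s≤s z≤n)) Fk≤0)))
  (λ F-top → subst (λ t → 1 ≤ toℕ t) (sym (F-top zero)) (s≤s z≤n))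

classification-finite : ∀ (m n : ℕ) (F : Hom (suc m) (suc n)) →
    (HasLeftAdjoints 1 F ⇔ (F · zero ≡ zero))
  × (HasLeftAdjoints 2 F ⇔ ((F · zero ≡ zero) × (1 ≤ toℕ (F · suc zero))))
  × (HasLeftAdjoints 3 F ⇔ ((F · zero ≡ zero) × (toℕ (F · suc zero) ≡ 1)))
  × (HasRightAdjoints 1 F ⇔ (toℕ (F · fromℕ (suc n)) < suc (suc m)))
  × (HasRightAdjoints 2 F ⇔ (toℕ (F · fromℕ (suc n)) ≡ suc m))
classification-finite m n F =
    has-left-adjoint F , has-two-left-adjoints F , has-three-left-adjoints F
  , has-right-adjoint F , has-two-right-adjoints F

-- m = -1, n ≥ 0: a third left adjoint comes for free, since the second one
-- lies in Hom(-1, n).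
classification-empty-source : ∀ (n : ℕ) (F : Hom 0 (suc n)) →
    (HasLeftAdjoints 1 F ⇔ Σ ℕ (λ j → ∀ (k : Fin (suc (suc n))) →
          (toℕ k ≤ j → F · k ≡ zero) × (j < toℕ k → F · k ≡ suc zero)))
  × (HasLeftAdjoints 2 F ⇔ ((F · zero ≡ zero) × (∀ k → F · suc k ≡ suc zero)))
  × (HasLeftAdjoints 3 F ⇔ ((F · zero ≡ zero) × (∀ k → F · suc k ≡ suc zero)))
  × (HasRightAdjoints 1 F ⇔ (∀ k → F · k ≡ zero))
  × (HasRightAdjoints 2 F ⇔ (∀ k → F · k ≡ zero))
classification-empty-source n F =
    threshold-form F , two-left , three-left
  , ⇔-trans (has-right-adjoint F) (⇔-trans <1⇔≡0 (constant-bottom F))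
  , ⇔-trans (has-two-right-adjoints F) (constant-bottom F)
  where
  two-left : HasLeftAdjoints 2 F ⇔ ((F · zero ≡ zero) × (∀ k → F · suc k ≡ suc zero))
  two-left = ⇔-trans (has-two-left-adjoints F) (⇔-refl ×-⇔ jumps-at-zero F)
  three-left : HasLeftAdjoints 3 F ⇔ ((F · zero ≡ zero) × (∀ k → F · suc k ≡ suc zero))
  three-left = mk⇔
    (λ { (L , L⊣F , L′ , L′⊣L , _) → to two-left (L , L⊣F , L′ , L′⊣L , tt) })
    (λ shape → let (L , L⊣F , L′ , L′⊣L , tt) = from two-left shape
               in L , L⊣F , L′ , L′⊣L , left-adjoint-from-Hom0 L′ L L′⊣L)
  <1⇔≡0 : ∀ {k} → (k < 1) ⇔ (k ≡ 0)
  <1⇔≡0 = mk⇔ n<1⇒n≡0 (λ { refl → s≤s z≤n })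

-- m ≥ 0, n = -1: the first left adjoint lies in Hom(-1, m), so a second one
-- comes for free, while a third would force  0 · L ≥ 0 , impossible there.
classification-empty-target : ∀ (m : ℕ) (F : Hom (suc m) 0) →
    (HasLeftAdjoints 1 F ⇔ (F · zero ≡ zero))
  × (HasLeftAdjoints 2 F ⇔ (F · zero ≡ zero))
  × (¬ HasLeftAdjoints 3 F)
  × (HasRightAdjoints 1 F ⇔ (toℕ (F · zero) < suc (suc m)))
  × (HasRightAdjoints 2 F ⇔ (toℕ (F · zero) ≡ suc m))
classification-empty-target m F =
    has-left-adjoint F
  , mk⇔ (λ { (L , L⊣F , _) → right-adjoint-bottom L F L⊣F })
        (λ F-zero → let (L , L⊣F , tt) = from (has-left-adjoint F) F-zero
                    in L , L⊣F , left-adjoint-from-Hom0 L F L⊣F)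
  , (λ { (L , L⊣F , L-chain) → <⇒≱ (proj₂ (to (has-two-left-adjoints L) L-chain))
                                   (bounded (adjoint⇒galois L F L⊣F) (suc zero)) })
  , has-right-adjoint F , has-two-right-adjoints F

classification-empty-both : ∀ (F : Hom 0 0) →
    ((F · zero ≡ zero) ⊎ (F · zero ≡ suc zero))
  × ((F · zero ≡ zero) → (∀ k → F · k ≡ idʳ k) × (F ⊣ F))
  × ((F · zero ≡ suc zero) → (¬ HasLeftAdjoints 1 F) × (¬ HasRightAdjoints 1 F))
classification-empty-both F =
    two-values (F · zero)
  , (λ F-zero → let F-id = identity F-zero in F-id , identity-self-adjoint F F-id)
  , (λ F-top → (λ has-left → 0≢1+n (trans (sym (to (has-left-adjoint F) has-left)) F-top))
             , (λ has-right → 1+n≰n (subst (λ t → toℕ t < 1) F-top (to (has-right-adjoint F) has-right))))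
  where
  two-values : (i : Fin 2) → (i ≡ zero) ⊎ (i ≡ suc zero)
  two-values zero       = inj₁ refl
  two-values (suc zero) = inj₂ refl
  identity : F · zero ≡ zero → ∀ k → F · k ≡ idʳ k
  identity F-zero zero = F-zero

mainTheorem14 :
    (∀ (m n : ℕ) (F : Hom (suc m) (suc n)) →
        (HasLeftAdjoints 1 F ⇔ (F · zero ≡ zero))
      × (HasLeftAdjoints 2 F ⇔ ((F · zero ≡ zero) × (1 ≤ toℕ (F · suc zero))))
      × (HasLeftAdjoints 3 F ⇔ ((F · zero ≡ zero) × (toℕ (F · suc zero) ≡ 1)))
      × (HasRightAdjoints 1 F ⇔ (toℕ (F · fromℕ (suc n)) < suc (suc m)))
      × (HasRightAdjoints 2 F ⇔ (toℕ (F · fromℕ (suc n)) ≡ suc m)))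
    × (∀ (n : ℕ) (F : Hom 0 (suc n)) →
        (HasLeftAdjoints 1 F ⇔ Σ ℕ (λ j → ∀ (k : Fin (suc (suc n))) →
              (toℕ k ≤ j → F · k ≡ zero) × (j < toℕ k → F · k ≡ suc zero)))
      × (HasLeftAdjoints 2 F ⇔ ((F · zero ≡ zero) × (∀ k → F · suc k ≡ suc zero)))
      × (HasLeftAdjoints 3 F ⇔ ((F · zero ≡ zero) × (∀ k → F · suc k ≡ suc zero)))
      × (HasRightAdjoints 1 F ⇔ (∀ k → F · k ≡ zero))
      × (HasRightAdjoints 2 F ⇔ (∀ k → F · k ≡ zero)))
    × (∀ (m : ℕ) (F : Hom (suc m) 0) →
        (HasLeftAdjoints 1 F ⇔ (F · zero ≡ zero))
      × (HasLeftAdjoints 2 F ⇔ (F · zero ≡ zero))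
      × (¬ HasLeftAdjoints 3 F)
      × (HasRightAdjoints 1 F ⇔ (toℕ (F · zero) < suc (suc m)))
      × (HasRightAdjoints 2 F ⇔ (toℕ (F · zero) ≡ suc m)))
    × (∀ (F : Hom 0 0) →
        ((F · zero ≡ zero) ⊎ (F · zero ≡ suc zero))
      × ((F · zero ≡ zero) → (∀ k → F · k ≡ idʳ k) × (F ⊣ F))
      × ((F · zero ≡ suc zero) → (¬ HasLeftAdjoints 1 F) × (¬ HasRightAdjoints 1 F)))
mainTheorem14 =
  classification-finite , classification-empty-source , classification-empty-target , classification-empty-both
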